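{- Let $A$ be a finite alphabet with $|A|\geq 2$. For every $k\geq 1$, $\mathcal{L}_{1/2}(k)\subsetneq\mathcal{L}_{1/2}(k+1)$.
   Context: $\mathcal{L}_{1/2}$ is the class of finite unions of languages $A^*a_1A^*a_2A^*\cdots A^*a_nA^*$ ($n\geq 0$, $a_i\in A$). For $k\geq1$, $\mathcal{L}_{1/2}(k)=\{L_1\triangle L_2\triangle\cdots\triangle L_k: L_1,\dots,L_k\in\mathcal{L}_{1/2}\}$, where $\triangle$ is symmetric difference. -}

module Defs where

open import Level using (0ℓ)
open import Data.Nat using (ℕ; suc)
open import Data.Fin using (Fin)
open import Data.List using (List; []; _∷_; _++_)
open import Data.List.Membership.Propositional using (_∈_)
open import Data.Vec using (Vec; []; _∷_)
open import Data.Product using (Σ; ∃; ∃-syntax; _×_; _,_)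
open import Data.Sum using (_⊎_)
open import Relation.Nullary using (¬_)
open import Relation.Binary.PropositionalEquality using (_≡_)
open import Function.Bundles using (_⇔_)

Word : ℕ → Set
Word n = List (Fin n)

Lang : ℕ → Set₁
Lang n = Word n → Set

-- w ∈ A* a₁ A* a₂ A* ⋯ A* aₘ A*   (for u = a₁ a₂ ⋯ aₘ)
data InPiece {n : ℕ} : Word n → Word n → Set where
  nil  : ∀ {w} → InPiece [] w
  cons : ∀ {a u w} (v w' : Word n) → w ≡ v ++ (a ∷ w') → InPiece u w' →
         InPiece (a ∷ u) w

-- A language of L_{1/2}, presented as a finite union of such pieces
-- (given by the finite list of words a₁⋯aₘ)
unionOfPieces : ∀ {n} → List (Word n) → Lang n
unionOfPieces us w = ∃[ u ] (u ∈ us × InPiece u w)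

InL½ : ∀ {n} → Lang n → Set
InL½ {n} L = ∃[ us ] (∀ (w : Word n) → L w ⇔ unionOfPieces us w)

_△_ : ∀ {n} → Lang n → Lang n → Lang n
(L △ M) w = (L w × ¬ M w) ⊎ (M w × ¬ L w)

symDiffs : ∀ {n m} → Vec (Lang n) (suc m) → Lang n
symDiffs (L ∷ [])     = L
symDiffs (L ∷ M ∷ Ls) = L △ symDiffs (M ∷ Ls)

-- membership of a language in L_{1/2}(k), k = suc m ≥ 1
InL½[_] : ℕ → ∀ {n} → Lang n → Set₁
InL½[_] m {n} L =
  Σ (Vec (Lang n) (suc m)) λ Ls →
    ((∀ i → InL½ (Data.Vec.lookup Ls i)) ×
     (∀ (w : Word n) → L w ⇔ symDiffs Ls w))

{-# OPTIONS --safe #-}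
-- Every language of L_{1/2} is closed under inserting letters, so along the
-- chain 1, a, a², … its membership changes at most once, and a symmetric
-- difference of k such languages changes at most k times. The symmetric
-- difference of A*aA*, A*aA*aA*, …, (A*a)^{k+1}A* contains aʲ exactly when
-- min(j, k+1) is odd, so it changes k+1 times on 1, a, …, a^{k+1}. The
-- changes can be counted on Booleans because membership in L_{1/2} is a
-- decidable subword test. Only one letter of A is needed.
module Submission where

open import Defs
open import Algebra.Bundles using (CommutativeRing)
open import Data.Bool using (Bool; true; false; not; _xor_; T)
open import Data.Bool.Properties using (xor-∧-commutativeRing)
open import Data.Empty using (⊥-elim)
open import Data.Fin using (Fin; zero; suc; _≟_)
open import Data.List using (List; []; _∷_; replicate)
open import Data.List.Properties using (length-replicate)
open import Data.List.Membership.Propositional using (find; lose)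
open import Data.List.Relation.Unary.Any using (Any; any?; here; there)
open import Data.List.Relation.Binary.Sublist.Propositional using (_⊆_; []; _∷_; _∷ʳ_)
import Data.List.Relation.Binary.Sublist.DecPropositional as DecSublist
open import Data.List.Relation.Binary.Sublist.Propositional.Properties using ([]⊆-universal; ++⁺ˡ; length-mono-≤)
open import Data.Nat using (ℕ; zero; suc; _+_; _≤_; _<_; z≤n; s≤s)
open import Data.Nat.Properties using (≤-refl; ≤-reflexive; ≤-trans; +-comm; +-commutativeSemigroup; n≤1+n; +-mono-≤; +-monoˡ-≤; 1+n≰n; <⇒≱; m≤n⇒m<n∨m≡n; module ≤-Reasoning)
open import Data.Product using (Σ; _×_; _,_; proj₁)
open import Data.Sum using (_⊎_; inj₁; inj₂; [_,_])
open import Data.Unit using (tt)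
open import Data.Vec using (Vec; []; _∷_; lookup)
open import Function using (_∘_)
open import Function.Bundles using (_⇔_; mk⇔; Equivalence)
import Function.Properties.Equivalence as ⇔
open import Relation.Nullary using (¬_; yes; no; _because_; does; proof)
open import Relation.Nullary.Decidable using (map′; dec-true; dec-false; does-⇔)
open import Relation.Nullary.Reflects using (Reflects; ofʸ; ofⁿ)
open import Relation.Unary using (Decidable)
open import Relation.Binary.PropositionalEquality using (_≡_; refl; sym; trans; cong; cong₂; subst₂)
open import Algebra.Properties.CommutativeSemigroup
  (CommutativeRing.+-commutativeSemigroup xor-∧-commutativeRing) using () renaming (interchange to xor-interchange)
open import Algebra.Properties.CommutativeSemigroup +-commutativeSemigroup using () renaming (interchange to +-interchange)

open Equivalence using (to; from)

private
  variable
    n m : ℕ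

bit : Bool → ℕ
bit false = 0
bit true  = 1

bit-xor-≤ : ∀ x y → bit (x xor y) ≤ bit x + bit y
bit-xor-≤ false y     = ≤-refl
bit-xor-≤ true  false = s≤s z≤n
bit-xor-≤ true  true  = z≤n

bit-xor-monotone : ∀ x y → (T x → T y) → bit x + bit (x xor y) ≡ bit y
bit-xor-monotone false y     _   = refl
bit-xor-monotone true  false x⇒y = ⊥-elim (x⇒y tt)
bit-xor-monotone true  true  _   = refl

bit≤1 : ∀ x → bit x ≤ 1
bit≤1 false = z≤n
bit≤1 true  = ≤-refl

changes : (ℕ → Bool) → ℕ → ℕ
changes f zero    = 0
changes f (suc N) = changes f N + bit (f N xor f (suc N))

changes-xor : ∀ f g N → changes (λ j → f j xor g j) N ≤ changes f N + changes g N
changes-xor f g zero    = z≤n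
changes-xor f g (suc N) = begin
  changes (λ j → f j xor g j) N + bit ((f N xor g N) xor (f (suc N) xor g (suc N)))
    ≤⟨ +-mono-≤ (changes-xor f g N) (≤-reflexive (cong bit (xor-interchange (f N) (g N) (f (suc N)) (g (suc N))))) ⟩
  (changes f N + changes g N) + bit ((f N xor f (suc N)) xor (g N xor g (suc N)))
    ≤⟨ +-mono-≤ ≤-refl (bit-xor-≤ (f N xor f (suc N)) (g N xor g (suc N))) ⟩
  (changes f N + changes g N) + (bit (f N xor f (suc N)) + bit (g N xor g (suc N)))
    ≡⟨ +-interchange (changes f N) (changes g N) _ _ ⟩
  changes f (suc N) + changes g (suc N) ∎
  where open ≤-Reasoning

changes-monotone : ∀ f → (∀ j → T (f j) → T (f (suc j))) → ∀ N → changes f N ≤ bit (f N)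
changes-monotone f mono zero    = z≤n
changes-monotone f mono (suc N) = begin
  changes f N + bit (f N xor f (suc N)) ≤⟨ +-monoˡ-≤ _ (changes-monotone f mono N) ⟩
  bit (f N) + bit (f N xor f (suc N))   ≡⟨ bit-xor-monotone (f N) (f (suc N)) (mono N) ⟩
  bit (f (suc N))                       ∎
  where open ≤-Reasoning

changes-cong : ∀ {f g} N → (∀ j → j ≤ N → f j ≡ g j) → changes f N ≡ changes g N
changes-cong zero    f≗g = refl
changes-cong (suc N) f≗g = cong₂ _+_
  (changes-cong N (λ j j≤N → f≗g j (≤-trans j≤N (n≤1+n N))))
  (cong bit (cong₂ _xor_ (f≗g N (n≤1+n N)) (f≗g (suc N) ≤-refl)))

odd : ℕ → Bool
odd zero    = false
odd (suc j) = not (odd j)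

changes-odd : ∀ N → changes odd N ≡ N
changes-odd zero    = refl
changes-odd (suc N) = trans (cong₂ _+_ (changes-odd N) (bit-xor-not (odd N))) (+-comm N 1)
  where
  bit-xor-not : ∀ x → bit (x xor not x) ≡ 1
  bit-xor-not false = refl
  bit-xor-not true  = refl

InPiece-∷ : ∀ {u w : Word n} x → InPiece u w → InPiece u (x ∷ w)
InPiece-∷ x nil                = nil
InPiece-∷ x (cons v w' refl p) = cons (x ∷ v) w' refl p

InPiece⇒⊆ : ∀ {u w : Word n} → InPiece u w → u ⊆ w
InPiece⇒⊆ nil                = []⊆-universal _
InPiece⇒⊆ (cons v w' refl p) = ++⁺ˡ v (refl ∷ InPiece⇒⊆ p)

⊆⇒InPiece : ∀ {u w : Word n} → u ⊆ w → InPiece u w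
⊆⇒InPiece []           = nil
⊆⇒InPiece (x ∷ʳ u⊆w)   = InPiece-∷ x (⊆⇒InPiece u⊆w)
⊆⇒InPiece (refl ∷ u⊆w) = cons [] _ refl (⊆⇒InPiece u⊆w)

unionOfPieces? : (us : List (Word n)) → Decidable (unionOfPieces us)
unionOfPieces? us w = map′ fromAny toAny (any? (λ u → DecSublist._⊆?_ _≟_ u w) us)
  where
  fromAny : Any (_⊆ w) us → unionOfPieces us w
  fromAny u⊆w∈us = let u , u∈us , u⊆w = find u⊆w∈us in u , u∈us , ⊆⇒InPiece u⊆w
  toAny : unionOfPieces us w → Any (_⊆ w) us
  toAny (u , u∈us , p) = lose u∈us (InPiece⇒⊆ p)

unionOfPieces-∷ : ∀ (us : List (Word n)) {w} x → unionOfPieces us w → unionOfPieces us (x ∷ w)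
unionOfPieces-∷ us x (u , u∈us , p) = u , u∈us , InPiece-∷ x p

InL½-unionOfPieces : (us : List (Word n)) → InL½ (unionOfPieces us)
InL½-unionOfPieces us = us , λ w → ⇔.refl

InL½⇒Decidable : {L : Lang n} → InL½ L → Decidable L
InL½⇒Decidable (us , L≡us) w = map′ (from (L≡us w)) (to (L≡us w)) (unionOfPieces? us w)

InL½⇒∷-closed : {L : Lang n} → InL½ L → ∀ {w} x → L w → L (x ∷ w)
InL½⇒∷-closed (us , L≡us) x Lw = from (L≡us _) (unionOfPieces-∷ us x (to (L≡us _) Lw))

reflects-△ : ∀ {P Q : Set} {p q} → Reflects P p → Reflects Q q →
             Reflects ((P × ¬ Q) ⊎ (Q × ¬ P)) (p xor q)
reflects-△ (ofʸ P)  (ofʸ Q)  = ofⁿ [ (λ (_ , ¬Q) → ¬Q Q) , (λ (_ , ¬P) → ¬P P) ]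
reflects-△ (ofʸ P)  (ofⁿ ¬Q) = ofʸ (inj₁ (P , ¬Q))
reflects-△ (ofⁿ ¬P) (ofʸ Q)  = ofʸ (inj₂ (Q , ¬P))
reflects-△ (ofⁿ ¬P) (ofⁿ ¬Q) = ofⁿ [ ¬P ∘ proj₁ , ¬Q ∘ proj₁ ]

_△?_ : {L M : Lang n} → Decidable L → Decidable M → Decidable (L △ M)
(L? △? M?) w = (does (L? w) xor does (M? w)) because reflects-△ (proof (L? w)) (proof (M? w))

symDiffs? : (Ls : Vec (Lang n) (suc m)) → (∀ i → Decidable (lookup Ls i)) → Decidable (symDiffs Ls)
symDiffs? (L ∷ [])     Ls? = Ls? zero
symDiffs? (L ∷ M ∷ Ls) Ls? = Ls? zero △? symDiffs? (M ∷ Ls) (Ls? ∘ suc)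

∅ : Lang n
∅ = unionOfPieces []

∅-△ : {L : Lang n} {w : Word n} → (∅ △ L) w ⇔ L w
∅-△ = mk⇔ (λ { (inj₁ ((_ , () , _) , _)) ; (inj₂ (Lw , _)) → Lw })
          (λ Lw → inj₂ (Lw , λ { (_ , () , _) }))

InL½[]-suc : {L : Lang n} → InL½[ m ] L → InL½[ suc m ] L
InL½[]-suc (Ls@(_ ∷ _) , Ls∈ , L≡Ls) =
  ∅ ∷ Ls ,
  (λ { zero → InL½-unionOfPieces [] ; (suc i) → Ls∈ i }) ,
  λ w → ⇔.trans (L≡Ls w) (⇔.sym (∅-△ {L = symDiffs Ls}))

InL½[]-symDiffs : (Ls : Vec (Lang n) (suc m)) → (∀ i → InL½ (lookup Ls i)) → InL½[ m ] (symDiffs Ls)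
InL½[]-symDiffs Ls Ls∈ = Ls , Ls∈ , λ w → ⇔.refl

module OnPowersOf {n : ℕ} (a : Fin n) where

  χ : {L : Lang n} → Decidable L → ℕ → Bool
  χ L? j = does (L? (replicate j a))

  χ-monotone : {L : Lang n} (L? : Decidable L) → (∀ {w} → L w → L (a ∷ w)) →
               ∀ j → T (χ L? j) → T (χ L? (suc j))
  χ-monotone L? closed j χj with L? (replicate j a) | L? (a ∷ replicate j a)
  ... | _      | yes _   = tt
  ... | yes Lw | no ¬aLw = ⊥-elim (¬aLw (closed Lw))
  ... | no _   | no _    = χj

  changes-∷-closed : {L : Lang n} (L? : Decidable L) → (∀ {w} → L w → L (a ∷ w)) →
                     ∀ N → changes (χ L?) N ≤ 1
  changes-∷-closed L? closed N =
    ≤-trans (changes-monotone (χ L?) (χ-monotone L? closed) N) (bit≤1 (χ L? N))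

  -- symDiffs? (L ∷ Ls) only unfolds once Ls is visibly a cons.
  χ-symDiffs-∷ : ∀ {L} (Ls : Vec (Lang n) (suc m)) (Ls? : ∀ i → Decidable (lookup (L ∷ Ls) i)) j →
                 χ (symDiffs? (L ∷ Ls) Ls?) j ≡ χ (Ls? zero) j xor χ (symDiffs? Ls (Ls? ∘ suc)) j
  χ-symDiffs-∷ (_ ∷ _) Ls? j = refl

  changes-symDiffs : (Ls : Vec (Lang n) (suc m)) (Ls? : ∀ i → Decidable (lookup Ls i)) →
                     (∀ i {w} → lookup Ls i w → lookup Ls i (a ∷ w)) →
                     ∀ N → changes (χ (symDiffs? Ls Ls?)) N ≤ suc m
  changes-symDiffs (L ∷ [])     Ls? closed N = changes-∷-closed (Ls? zero) (closed zero) N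
  changes-symDiffs (L ∷ M ∷ Ls) Ls? closed N = ≤-trans
    (changes-xor (χ (Ls? zero)) (χ (symDiffs? (M ∷ Ls) (Ls? ∘ suc))) N)
    (+-mono-≤ (changes-∷-closed (Ls? zero) (closed zero) N)
              (changes-symDiffs (M ∷ Ls) (Ls? ∘ suc) (closed ∘ suc) N))

  atLeast : ℕ → Lang n
  atLeast t = unionOfPieces (replicate t a ∷ [])

  replicate-⊆ : ∀ {t j} → t ≤ j → replicate t a ⊆ replicate j a
  replicate-⊆ z≤n       = []⊆-universal _
  replicate-⊆ (s≤s t≤j) = refl ∷ replicate-⊆ t≤j

  atLeast-replicate : ∀ {t j} → atLeast t (replicate j a) ⇔ t ≤ j
  atLeast-replicate {t} {j} = mk⇔
    (λ { (_ , here refl , p) → subst₂ _≤_ (length-replicate t) (length-replicate j) (length-mono-≤ (InPiece⇒⊆ p))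
       ; (_ , there () , _) })
    (λ t≤j → _ , here refl , ⊆⇒InPiece (replicate-⊆ t≤j))

  χ-atLeast-≤ : ∀ {t j} (L? : Decidable (atLeast t)) → t ≤ j → χ L? j ≡ true
  χ-atLeast-≤ L? t≤j = dec-true (L? _) (from atLeast-replicate t≤j)

  χ-atLeast-> : ∀ {t j} (L? : Decidable (atLeast t)) → j < t → χ L? j ≡ false
  χ-atLeast-> L? j<t = dec-false (L? _) (<⇒≱ j<t ∘ to atLeast-replicate)

  staircase : (K : ℕ) → Vec (Lang n) (suc K)
  staircase zero    = atLeast 1 ∷ []
  staircase (suc K) = atLeast (suc (suc K)) ∷ staircase K

  staircase-InL½ : ∀ K i → InL½ (lookup (staircase K) i)
  staircase-InL½ zero    zero    = InL½-unionOfPieces _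
  staircase-InL½ (suc K) zero    = InL½-unionOfPieces _
  staircase-InL½ (suc K) (suc i) = staircase-InL½ K i

  χ-staircase-≥ : ∀ K St? j → suc K ≤ j → χ (symDiffs? (staircase K) St?) j ≡ odd (suc K)
  χ-staircase-≥ zero    St? j 1≤j   = χ-atLeast-≤ (St? zero) 1≤j
  χ-staircase-≥ (suc K) St? j 2+K≤j = trans (χ-symDiffs-∷ (staircase K) St? j) (cong₂ _xor_
    (χ-atLeast-≤ (St? zero) 2+K≤j)
    (χ-staircase-≥ K (St? ∘ suc) j (≤-trans (n≤1+n _) 2+K≤j)))

  χ-staircase-≤ : ∀ K St? j → j ≤ suc K → χ (symDiffs? (staircase K) St?) j ≡ odd j
  χ-staircase-≤ zero    St? zero          _         = χ-atLeast-> (St? zero) (s≤s z≤n)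
  χ-staircase-≤ zero    St? (suc zero)    _         = χ-atLeast-≤ (St? zero) ≤-refl
  χ-staircase-≤ zero    St? (suc (suc j)) (s≤s ())
  χ-staircase-≤ (suc K) St? j j≤2+K with m≤n⇒m<n∨m≡n j≤2+K
  ... | inj₁ (s≤s j≤1+K) = trans (χ-symDiffs-∷ (staircase K) St? j) (cong₂ _xor_
    (χ-atLeast-> (St? zero) (s≤s j≤1+K))
    (χ-staircase-≤ K (St? ∘ suc) j j≤1+K))
  ... | inj₂ refl        = χ-staircase-≥ (suc K) St? j ≤-refl

  staircase-∉ : ∀ m → ¬ InL½[ m ] (symDiffs (staircase (suc m)))
  staircase-∉ m (Ls , Ls∈ , St≡Ls) = 1+n≰n (begin
    suc (suc m)                    ≡⟨ changes-odd _ ⟨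
    changes odd (suc (suc m))      ≡⟨ changes-cong _ odd≗χ ⟩
    changes (χ Ls?) (suc (suc m))  ≤⟨ changes-symDiffs Ls _ (λ i → InL½⇒∷-closed (Ls∈ i) a) _ ⟩
    suc m                          ∎)
    where
    open ≤-Reasoning
    Ls? = symDiffs? Ls (InL½⇒Decidable ∘ Ls∈)
    St? = symDiffs? (staircase (suc m)) (InL½⇒Decidable ∘ staircase-InL½ (suc m))
    odd≗χ : ∀ j → j ≤ suc (suc m) → odd j ≡ χ Ls? j
    odd≗χ j j≤2+m = trans (sym (χ-staircase-≤ (suc m) _ j j≤2+m))
                          (does-⇔ (St≡Ls (replicate j a)) (St? _) (Ls? _))

theorem4p3 : (n : ℕ) → 2 ≤ n → (m : ℕ) →
    ((L : Lang n) → InL½[ m ] L → InL½[ suc m ] L) ×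
    (Σ (Lang n) λ L → (InL½[ suc m ] L × ¬ InL½[ m ] L))
theorem4p3 zero    ()  m
theorem4p3 (suc n) _   m =
  (λ L → InL½[]-suc) ,
  symDiffs (staircase (suc m)) , InL½[]-symDiffs (staircase (suc m)) (staircase-InL½ (suc m)) , staircase-∉ m
  where open OnPowersOf {suc n} zero
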